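{- Let $D=(E,\mathcal F)$ be a delta-matroid and let $X$ be a subset of $E$ that is not feasible (i.e. $X\notin\mathcal F$). Let $\mathcal B$ be the collection of all sets $Y\subseteq E$ of the smallest possible size such that $X\bigtriangleup Y\in\mathcal F$. Then $\mathcal B$ is the collection of bases of a matroid with ground set $E$.
   Context: A delta-matroid $(E,\mathcal F)$ consists of a finite set $E$ and a non-empty collection $\mathcal F$ of subsets of $E$ (the feasible sets) satisfying: for all $X,Y\in\mathcal F$ and every $e\in X\bigtriangleup Y$ there exists $f\in X\bigtriangleup Y$ (possibly $f=e$) with $X\bigtriangleup\{e,f\}\in\mathcal F$. -}

module Defs where

open import Data.Nat using (ℕ; _≤_)
open import Data.Bool using (Bool; _xor_)
open import Data.Vec using (zipWith)
open import Data.Fin using (Fin)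
open import Data.Fin.Subset using (Subset; _∈_; _∉_; _─_; _∪_; ⁅_⁆; ∣_∣)
open import Data.Product using (Σ; ∃; _×_)
open import Relation.Unary using (Pred; Decidable)
open import Relation.Nullary using (¬_)
open import Level using (0ℓ)

_△_ : ∀ {n} → Subset n → Subset n → Subset n
X △ Y = zipWith _xor_ X Y

-- Delta-matroid on Fin n: a non-empty collection 𝓕 of feasible sets
-- (given as a decidable predicate; every family of subsets of a finite set
-- is decidable classically) satisfying the symmetric exchange axiom.
record IsDeltaMatroid {n : ℕ} (𝓕 : Pred (Subset n) 0ℓ) : Set where
  field
    decidable : Decidable 𝓕
    nonempty  : ∃ λ X → 𝓕 X
    exchange  : ∀ X Y → 𝓕 X → 𝓕 Y → ∀ e → e ∈ (X △ Y) →
                ∃ λ f → f ∈ (X △ Y) × 𝓕 (X △ (⁅ e ⁆ ∪ ⁅ f ⁆))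

record IsMatroidBases {n : ℕ} (𝓑 : Pred (Subset n) 0ℓ) : Set where
  field
    nonempty : ∃ λ B → 𝓑 B
    exchange : ∀ B₁ B₂ → 𝓑 B₁ → 𝓑 B₂ → ∀ e → e ∈ B₁ → e ∉ B₂ →
               ∃ λ f → f ∈ B₂ × f ∉ B₁ × 𝓑 ((B₁ ─ ⁅ e ⁆) ∪ ⁅ f ⁆)

MinCorrections : ∀ {n} → Pred (Subset n) 0ℓ → Subset n → Pred (Subset n) 0ℓ
MinCorrections 𝓕 X Y = 𝓕 (X △ Y) × (∀ Z → 𝓕 (X △ Z) → ∣ Y ∣ ≤ ∣ Z ∣)

-- Translate by X: Y is a correction when X △ Y is feasible, so the corrections
-- form the delta-matroid twisted by X, and the minimum corrections are its
-- feasible sets of least size. For minimum corrections B₁, B₂ and e ∈ B₁ ∖ B₂,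
-- the symmetric exchange axiom yields f ∈ B₁ △ B₂ with B₁ △ {e, f} a correction.
-- If f = e or f ∈ B₁ this correction is smaller than B₁, which is impossible;
-- hence f ∈ B₂ ∖ B₁ and B₁ △ {e, f} = (B₁ ∖ e) ∪ f is again a minimum correction.
module Submission where

open import Defs
open import Data.Nat using (ℕ; suc; _≤_; _<_; _<?_)
open import Data.Nat.Properties using (≤-reflexive; ≤-trans; ≮⇒≥; <⇒≱; n<1+n; module ≤-Reasoning)
open import Data.Nat.Induction using (<-wellFounded)
open import Data.Bool.Properties using (xor-assoc; xor-comm; xor-identityʳ; xor-same)
open import Data.Vec using ([]; _∷_)
open import Data.Vec.Properties using (zipWith-assoc; zipWith-comm; zipWith-identityʳ)
open import Data.Fin using (Fin; zero; suc; _≟_)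
open import Data.Fin.Subset using (Subset; _∈_; _∉_; _─_; _-_; _∪_; ⁅_⁆; ∣_∣; ⊥; inside; outside)
open import Data.Fin.Subset.Properties
  using (anySubset?; ∪-idem; ∪-identityʳ; p─⊥≡p; x≢y⇒x∉⁅y⁆; x∈⁅y⁆⇒x≡y)
open import Data.Vec.Base using (here; there)
open import Data.Product using (∃; _×_; _,_)
open import Function using (_∘_)
open import Data.Sum using (_⊎_; inj₁; inj₂)
open import Induction.WellFounded using (Acc; acc)
open import Relation.Unary using (Pred; Decidable)
open import Relation.Nullary using (¬_; yes; no; contradiction)
open import Relation.Nullary.Decidable using (_×-dec_)
open import Relation.Binary.PropositionalEquality
open import Level using (Level; 0ℓ)

private
  variable
    ℓ : Level
    n : ℕ
    x y : Fin n
    p : Subset n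

△-assoc : (p q r : Subset n) → (p △ q) △ r ≡ p △ (q △ r)
△-assoc = zipWith-assoc xor-assoc

△-comm : (p q : Subset n) → p △ q ≡ q △ p
△-comm = zipWith-comm xor-comm

△-identityʳ : (p : Subset n) → p △ ⊥ ≡ p
△-identityʳ = zipWith-identityʳ xor-identityʳ

△-self : (p : Subset n) → p △ p ≡ ⊥
△-self []      = refl
△-self (b ∷ p) = cong₂ _∷_ (xor-same b) (△-self p)

△-involutiveˡ : (p q : Subset n) → p △ (p △ q) ≡ q
△-involutiveˡ p q = begin
  p △ (p △ q)  ≡⟨ △-assoc p p q ⟨
  (p △ p) △ q  ≡⟨ cong (_△ q) (△-self p) ⟩
  ⊥ △ q        ≡⟨ △-comm ⊥ q ⟩
  q △ ⊥        ≡⟨ △-identityʳ q ⟩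
  q            ∎
  where open ≡-Reasoning

△-cancelˡ : (r p q : Subset n) → (r △ p) △ (r △ q) ≡ p △ q
△-cancelˡ r p q = begin
  (r △ p) △ (r △ q)  ≡⟨ △-assoc r p (r △ q) ⟩
  r △ (p △ (r △ q))  ≡⟨ cong (r △_) (△-assoc p r q) ⟨
  r △ ((p △ r) △ q)  ≡⟨ cong (λ s → r △ (s △ q)) (△-comm p r) ⟩
  r △ ((r △ p) △ q)  ≡⟨ cong (r △_) (△-assoc r p q) ⟩
  r △ (r △ (p △ q))  ≡⟨ △-involutiveˡ r (p △ q) ⟩
  p △ q              ∎
  where open ≡-Reasoning

x∈p△q⁺ : ∀ (p q : Subset n) → x ∈ p → x ∉ q → x ∈ p △ q
x∈p△q⁺ (inside ∷ p) (inside  ∷ q) here      x∉q = contradiction here x∉q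
x∈p△q⁺ (inside ∷ p) (outside ∷ q) here      x∉q = here
x∈p△q⁺ (_      ∷ p) (_       ∷ q) (there x∈p) x∉q =
  there (x∈p△q⁺ p q x∈p (λ x∈q → x∉q (there x∈q)))

x∈p△q⁻ : ∀ (p q : Subset n) → x ∈ p △ q → (x ∈ p × x ∉ q) ⊎ (x ∉ p × x ∈ q)
x∈p△q⁻ (inside  ∷ p) (outside ∷ q) here = inj₁ (here , λ ())
x∈p△q⁻ (outside ∷ p) (inside  ∷ q) here = inj₂ ((λ ()) , here)
x∈p△q⁻ (_ ∷ p) (_ ∷ q) (there x∈p△q) with x∈p△q⁻ p q x∈p△q
... | inj₁ (x∈p , x∉q) = inj₁ (there x∈p , λ { (there x∈q) → x∉q x∈q })
... | inj₂ (x∉p , x∈q) = inj₂ ((λ { (there x∈p) → x∉p x∈p }) , there x∈q)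

x∈p∧x≢y⇒x∈p△⁅y⁆ : x ∈ p → x ≢ y → x ∈ p △ ⁅ y ⁆
x∈p∧x≢y⇒x∈p△⁅y⁆ {p = p} x∈p x≢y = x∈p△q⁺ p _ x∈p (x≢y⇒x∉⁅y⁆ x≢y)

x∉p∧x≢y⇒x∉p△⁅y⁆ : ∀ {x} (y : Fin n) (p : Subset n) → x ∉ p → x ≢ y → x ∉ p △ ⁅ y ⁆
x∉p∧x≢y⇒x∉p△⁅y⁆ y p x∉p x≢y x∈p△⁅y⁆ with x∈p△q⁻ p ⁅ y ⁆ x∈p△⁅y⁆
... | inj₁ (x∈p , _) = x∉p x∈p
... | inj₂ (_ , x∈⁅y⁆) = x≢y (x∈⁅y⁆⇒x≡y y x∈⁅y⁆)

x∈p⇒p-x≡p△⁅x⁆ : x ∈ p → p - x ≡ p △ ⁅ x ⁆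
x∈p⇒p-x≡p△⁅x⁆ {x = zero}  {p = _ ∷ p} here =
  cong (outside ∷_) (trans (p─⊥≡p p) (sym (△-identityʳ p)))
x∈p⇒p-x≡p△⁅x⁆ {x = suc x} {p = inside  ∷ p} (there x∈p) = cong (inside ∷_)  (x∈p⇒p-x≡p△⁅x⁆ x∈p)
x∈p⇒p-x≡p△⁅x⁆ {x = suc x} {p = outside ∷ p} (there x∈p) = cong (outside ∷_) (x∈p⇒p-x≡p△⁅x⁆ x∈p)

x∉p⇒p∪⁅x⁆≡p△⁅x⁆ : x ∉ p → p ∪ ⁅ x ⁆ ≡ p △ ⁅ x ⁆
x∉p⇒p∪⁅x⁆≡p△⁅x⁆ {x = zero}  {p = inside ∷ p}  x∉p = contradiction here x∉p
x∉p⇒p∪⁅x⁆≡p△⁅x⁆ {x = zero}  {p = outside ∷ p} x∉p =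
  cong (inside ∷_) (trans (∪-identityʳ p) (sym (△-identityʳ p)))
x∉p⇒p∪⁅x⁆≡p△⁅x⁆ {x = suc x} {p = inside  ∷ p} x∉p =
  cong (inside ∷_)  (x∉p⇒p∪⁅x⁆≡p△⁅x⁆ (λ x∈p → x∉p (there x∈p)))
x∉p⇒p∪⁅x⁆≡p△⁅x⁆ {x = suc x} {p = outside ∷ p} x∉p =
  cong (outside ∷_) (x∉p⇒p∪⁅x⁆≡p△⁅x⁆ (λ x∈p → x∉p (there x∈p)))

x∈p⇒1+∣p△⁅x⁆∣≡∣p∣ : x ∈ p → suc ∣ p △ ⁅ x ⁆ ∣ ≡ ∣ p ∣
x∈p⇒1+∣p△⁅x⁆∣≡∣p∣ {x = zero}  {p = _ ∷ p} here = cong (λ s → suc ∣ s ∣) (△-identityʳ p)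
x∈p⇒1+∣p△⁅x⁆∣≡∣p∣ {x = suc x} {p = inside  ∷ p} (there x∈p) = cong suc (x∈p⇒1+∣p△⁅x⁆∣≡∣p∣ x∈p)
x∈p⇒1+∣p△⁅x⁆∣≡∣p∣ {x = suc x} {p = outside ∷ p} (there x∈p) = x∈p⇒1+∣p△⁅x⁆∣≡∣p∣ x∈p

x∉p⇒∣p△⁅x⁆∣≡1+∣p∣ : x ∉ p → ∣ p △ ⁅ x ⁆ ∣ ≡ suc ∣ p ∣
x∉p⇒∣p△⁅x⁆∣≡1+∣p∣ {x = zero}  {p = inside  ∷ p} x∉p = contradiction here x∉p
x∉p⇒∣p△⁅x⁆∣≡1+∣p∣ {x = zero}  {p = outside ∷ p} x∉p = cong (λ s → suc ∣ s ∣) (△-identityʳ p)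
x∉p⇒∣p△⁅x⁆∣≡1+∣p∣ {x = suc x} {p = inside  ∷ p} x∉p =
  cong suc (x∉p⇒∣p△⁅x⁆∣≡1+∣p∣ (λ x∈p → x∉p (there x∈p)))
x∉p⇒∣p△⁅x⁆∣≡1+∣p∣ {x = suc x} {p = outside ∷ p} x∉p =
  x∉p⇒∣p△⁅x⁆∣≡1+∣p∣ (λ x∈p → x∉p (there x∈p))

p△⁅x⁆∪⁅x⁆≡p△⁅x⁆ : (p : Subset n) (x : Fin n) → p △ (⁅ x ⁆ ∪ ⁅ x ⁆) ≡ p △ ⁅ x ⁆
p△⁅x⁆∪⁅x⁆≡p△⁅x⁆ p x = cong (p △_) (∪-idem ⁅ x ⁆)

x≢y⇒p△⁅x⁆∪⁅y⁆≡p△⁅x⁆△⁅y⁆ : (p : Subset n) → x ≢ y → p △ (⁅ x ⁆ ∪ ⁅ y ⁆) ≡ (p △ ⁅ x ⁆) △ ⁅ y ⁆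
x≢y⇒p△⁅x⁆∪⁅y⁆≡p△⁅x⁆△⁅y⁆ {x = x} {y = y} p x≢y = begin
  p △ (⁅ x ⁆ ∪ ⁅ y ⁆)  ≡⟨ cong (p △_) (x∉p⇒p∪⁅x⁆≡p△⁅x⁆ (x≢y⇒x∉⁅y⁆ (x≢y ∘ sym))) ⟩
  p △ (⁅ x ⁆ △ ⁅ y ⁆)  ≡⟨ △-assoc p ⁅ x ⁆ ⁅ y ⁆ ⟨
  (p △ ⁅ x ⁆) △ ⁅ y ⁆  ∎
  where open ≡-Reasoning

∃-minimum-size : {P : Pred (Subset n) ℓ} → Decidable P → ∃ P →
                 ∃ λ Y → P Y × (∀ Z → P Z → ∣ Y ∣ ≤ ∣ Z ∣)
∃-minimum-size {P = P} P? (Y , pY) = descend Y pY (<-wellFounded ∣ Y ∣)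
  where
  descend : ∀ Y → P Y → Acc _<_ ∣ Y ∣ → ∃ λ Y → P Y × (∀ Z → P Z → ∣ Y ∣ ≤ ∣ Z ∣)
  descend Y pY (acc smaller) with anySubset? (λ Z → P? Z ×-dec (∣ Z ∣ <? ∣ Y ∣))
  ... | yes (Z , pZ , ∣Z∣<∣Y∣) = descend Z pZ (smaller ∣Z∣<∣Y∣)
  ... | no  ∄smaller           = Y , pY , λ Z pZ → ≮⇒≥ (λ ∣Z∣<∣Y∣ → ∄smaller (Z , pZ , ∣Z∣<∣Y∣))

module _ {𝓕 : Pred (Subset n) 0ℓ} (D : IsDeltaMatroid 𝓕) (X : Subset n) where

  open IsDeltaMatroid D

  minCorrection-exists : ∃ (MinCorrections 𝓕 X)
  minCorrection-exists with nonempty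
  ... | F , F∈𝓕 = ∃-minimum-size (λ Y → decidable (X △ Y))
                    (X △ F , subst 𝓕 (sym (△-involutiveˡ X F)) F∈𝓕)

  below-minCorrection-infeasible : ∀ {B Z} → MinCorrections 𝓕 X B → ∣ Z ∣ < ∣ B ∣ → ¬ 𝓕 (X △ Z)
  below-minCorrection-infeasible (_ , B-min) ∣Z∣<∣B∣ Z-corr = <⇒≱ ∣Z∣<∣B∣ (B-min _ Z-corr)

  correction-exchange : ∀ {B₁ B₂ e} → 𝓕 (X △ B₁) → 𝓕 (X △ B₂) → e ∈ B₁ → e ∉ B₂ →
                        ∃ λ f → f ∈ B₁ △ B₂ × 𝓕 (X △ (B₁ △ (⁅ e ⁆ ∪ ⁅ f ⁆)))
  correction-exchange {B₁} {B₂} {e} B₁-corr B₂-corr e∈B₁ e∉B₂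
    with exchange (X △ B₁) (X △ B₂) B₁-corr B₂-corr e
           (subst (e ∈_) (sym (△-cancelˡ X B₁ B₂)) (x∈p△q⁺ B₁ B₂ e∈B₁ e∉B₂))
  ... | f , f∈ , corr = f , subst (f ∈_) (△-cancelˡ X B₁ B₂) f∈ , subst 𝓕 (△-assoc X B₁ _) corr

  swap-minCorrection : ∀ {B e f} → MinCorrections 𝓕 X B → e ∈ B → f ∉ B → f ≢ e →
                       𝓕 (X △ (B △ (⁅ e ⁆ ∪ ⁅ f ⁆))) → MinCorrections 𝓕 X ((B ─ ⁅ e ⁆) ∪ ⁅ f ⁆)
  swap-minCorrection {B} {e} {f} (_ , B-least) e∈B f∉B f≢e corr =
    subst (λ S → 𝓕 (X △ S)) B△⁅e⁆∪⁅f⁆≡B-e∪⁅f⁆ corr ,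
    λ Z Z-corr → ≤-trans (≤-reflexive same-size) (B-least Z Z-corr)
    where
    f∉B△⁅e⁆ : f ∉ B △ ⁅ e ⁆
    f∉B△⁅e⁆ = x∉p∧x≢y⇒x∉p△⁅y⁆ e B f∉B f≢e
    B-e∪⁅f⁆≡B△⁅e⁆△⁅f⁆ : (B ─ ⁅ e ⁆) ∪ ⁅ f ⁆ ≡ (B △ ⁅ e ⁆) △ ⁅ f ⁆
    B-e∪⁅f⁆≡B△⁅e⁆△⁅f⁆ = trans (cong (_∪ ⁅ f ⁆) (x∈p⇒p-x≡p△⁅x⁆ e∈B)) (x∉p⇒p∪⁅x⁆≡p△⁅x⁆ f∉B△⁅e⁆)
    B△⁅e⁆∪⁅f⁆≡B-e∪⁅f⁆ : B △ (⁅ e ⁆ ∪ ⁅ f ⁆) ≡ (B ─ ⁅ e ⁆) ∪ ⁅ f ⁆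
    B△⁅e⁆∪⁅f⁆≡B-e∪⁅f⁆ = trans (x≢y⇒p△⁅x⁆∪⁅y⁆≡p△⁅x⁆△⁅y⁆ B (f≢e ∘ sym)) (sym B-e∪⁅f⁆≡B△⁅e⁆△⁅f⁆)
    same-size : ∣ (B ─ ⁅ e ⁆) ∪ ⁅ f ⁆ ∣ ≡ ∣ B ∣
    same-size = begin
      ∣ (B ─ ⁅ e ⁆) ∪ ⁅ f ⁆ ∣      ≡⟨ cong ∣_∣ B-e∪⁅f⁆≡B△⁅e⁆△⁅f⁆ ⟩
      ∣ (B △ ⁅ e ⁆) △ ⁅ f ⁆ ∣      ≡⟨ x∉p⇒∣p△⁅x⁆∣≡1+∣p∣ f∉B△⁅e⁆ ⟩
      suc ∣ B △ ⁅ e ⁆ ∣            ≡⟨ x∈p⇒1+∣p△⁅x⁆∣≡∣p∣ e∈B ⟩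
      ∣ B ∣                        ∎
      where open ≡-Reasoning

  minCorrection-exchange : ∀ B₁ B₂ → MinCorrections 𝓕 X B₁ → MinCorrections 𝓕 X B₂ →
                           ∀ e → e ∈ B₁ → e ∉ B₂ →
                           ∃ λ f → f ∈ B₂ × f ∉ B₁ × MinCorrections 𝓕 X ((B₁ ─ ⁅ e ⁆) ∪ ⁅ f ⁆)
  minCorrection-exchange B₁ B₂ B₁-min@(B₁-corr , _) (B₂-corr , _) e e∈B₁ e∉B₂
    with correction-exchange B₁-corr B₂-corr e∈B₁ e∉B₂
  ... | f , f∈B₁△B₂ , corr with f ≟ e
  ...   | yes refl =
    contradiction (subst (λ S → 𝓕 (X △ S)) (p△⁅x⁆∪⁅x⁆≡p△⁅x⁆ B₁ e) corr)
                  (below-minCorrection-infeasible B₁-min (≤-reflexive (x∈p⇒1+∣p△⁅x⁆∣≡∣p∣ e∈B₁)))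
  ...   | no f≢e with x∈p△q⁻ B₁ B₂ f∈B₁△B₂
  ...     | inj₂ (f∉B₁ , f∈B₂) = f , f∈B₂ , f∉B₁ , swap-minCorrection B₁-min e∈B₁ f∉B₁ f≢e corr
  ...     | inj₁ (f∈B₁ , _) =
    contradiction (subst (λ S → 𝓕 (X △ S)) (x≢y⇒p△⁅x⁆∪⁅y⁆≡p△⁅x⁆△⁅y⁆ B₁ (f≢e ∘ sym)) corr)
                  (below-minCorrection-infeasible B₁-min ∣B₁△⁅e⁆△⁅f⁆∣<∣B₁∣)
    where
    ∣B₁△⁅e⁆△⁅f⁆∣<∣B₁∣ : ∣ (B₁ △ ⁅ e ⁆) △ ⁅ f ⁆ ∣ < ∣ B₁ ∣
    ∣B₁△⁅e⁆△⁅f⁆∣<∣B₁∣ = begin-strict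
      ∣ (B₁ △ ⁅ e ⁆) △ ⁅ f ⁆ ∣      <⟨ n<1+n _ ⟩
      suc ∣ (B₁ △ ⁅ e ⁆) △ ⁅ f ⁆ ∣  ≡⟨ x∈p⇒1+∣p△⁅x⁆∣≡∣p∣ (x∈p∧x≢y⇒x∈p△⁅y⁆ f∈B₁ f≢e) ⟩
      ∣ B₁ △ ⁅ e ⁆ ∣                <⟨ n<1+n _ ⟩
      suc ∣ B₁ △ ⁅ e ⁆ ∣            ≡⟨ x∈p⇒1+∣p△⁅x⁆∣≡∣p∣ e∈B₁ ⟩
      ∣ B₁ ∣                        ∎
      where open ≤-Reasoning

lemma19 : (n : ℕ) (𝓕 : Pred (Subset n) 0ℓ) → IsDeltaMatroid 𝓕 →
          (X : Subset n) → ¬ 𝓕 X → IsMatroidBases (MinCorrections 𝓕 X)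
lemma19 n 𝓕 D X _ = record
  { nonempty = minCorrection-exists D X
  ; exchange = minCorrection-exchange D X
  }
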